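{- For every integer $\ell\geq 1$ and every factor $u$ of the Cantor sequence $\mathbf c$ that contains at least one letter $1$ and satisfies $|u|>3^{\ell}$, we have $\mathrm{Card}(\mathrm{Type}(\ell, u))=1$.
   Context: The Cantor sequence $\mathbf{c}=c_0c_1c_2\cdots\in\{0,1\}^{\mathbb N}$ is defined by $c_0=1$ and $c_{3n}=c_{3n+2}=c_n$, $c_{3n+1}=0$ for all $n\geq 0$. For a factor $u$ of $\mathbf c$ and $\ell\geq1$, $\mathrm{Type}(\ell,u)=\{j\in\{0,1,\dots,3^\ell-1\}\mid u=c_{3^\ell n+j}\cdots c_{3^\ell n+j+|u|-1}\text{ for some }n\geq0\}$. -}

module Defs where

open import Data.Nat using (ℕ; zero; suc; _+_; _*_; _^_; _<_)
open import Data.Nat.DivMod using (_/_; _%_)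
open import Data.Bool using (Bool; true; false)
open import Data.List using (List; length; lookup)
open import Data.List.Membership.Propositional using (_∈_)
open import Data.Fin using (Fin; toℕ)
open import Data.Product using (Σ; ∃; _×_)
open import Relation.Binary.PropositionalEquality using (_≡_)

-- Cantor sequence, letters 0/1 encoded as false/true.
-- cFuel f n computes c_n provided f > n (fuel decreases structurally;
-- since n / 3 < n for n ≥ 1 the fuel n+1 always suffices).
cFuel : ℕ → ℕ → Bool
cFuel zero    n       = false
cFuel (suc f) zero    = true
cFuel (suc f) (suc n) with suc n % 3
... | 1 = false
... | _ = cFuel f (suc n / 3)

c : ℕ → Bool
c n = cFuel (suc n) n

OccursAt : List Bool → ℕ → Set
OccursAt u i = (k : Fin (length u)) → lookup u k ≡ c (i + toℕ k)

IsFactor : List Bool → Set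
IsFactor u = ∃ λ i → OccursAt u i

InType : ℕ → List Bool → ℕ → Set
InType ℓ u j = j < 3 ^ ℓ × ∃ λ n → OccursAt u (3 ^ ℓ * n + j)

CardOne : (ℕ → Set) → Set
CardOne P = ∃ λ j → P j × (∀ j' → P j' → j' ≡ j)

module Submission where

-- The proof is a "synchronisation" argument, by induction on ℓ.
--  * Every 1 of c sits at a position p with p ≡ 0 or p ≡ 2 (mod 3), and its
--    residue can be read off locally: the letters at p + 2 and p - 2 are
--    (1,0) when p ≡ 0 and (0,1) when p ≡ 2.  A window of length ≥ 4 around
--    the 1 always contains one of these two positions, so two positions y, y'
--    carrying the same word of length L > 3 satisfy y ≡ y' (mod 3).
--  * Writing y = r + 3Y and y' = r + 3Y', the substitution structure
--    c(3q) = c(3q+2) = c(q) shows that Y and Y' carry the same word of length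
--    ⌈(r + L)/3⌉ > 3^(ℓ-1), again containing a 1; the induction hypothesis
--    gives Y ≡ Y' (mod 3^(ℓ-1)), hence y ≡ y' (mod 3^ℓ).

open import Defs
open import Data.Bool using (Bool; true; false; not)
open import Data.Bool.Properties using (not-injective)
open import Data.Empty using (⊥-elim)
open import Data.Fin using (toℕ; fromℕ<)
open import Data.Fin.Properties using (toℕ-fromℕ<; toℕ<n)
open import Data.List using (List; length; lookup)
open import Data.List.Membership.Propositional using (_∈_)
open import Data.List.Relation.Unary.Any using (index)
open import Data.List.Relation.Unary.Any.Properties using (lookup-index)
open import Data.Nat
open import Data.Nat.DivMod
open import Data.Nat.Divisibility using (divides; m∣m*n)
open import Data.Nat.Properties
open import Data.Nat.Tactic.RingSolver using (solve-∀)
open import Data.Product using (∃; ∃₂; _×_; _,_)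
open import Relation.Nullary using (yes; no)
open import Relation.Binary.PropositionalEquality
open ≡-Reasoning

digit-% : ∀ e q → e < 3 → (e + q * 3) % 3 ≡ e
digit-% e q e<3 = trans ([m+kn]%n≡m%n e q 3) (m<n⇒m%n≡m e<3)

digit-/ : ∀ e q → e < 3 → (e + q * 3) / 3 ≡ q
digit-/ e q e<3 = begin
  (e + q * 3) / 3    ≡⟨ +-distrib-/-∣ʳ e (divides q refl) ⟩
  e / 3 + q * 3 / 3  ≡⟨ cong₂ _+_ (m<n⇒m/n≡0 e<3) (m*n/n≡m q 3) ⟩
  q                  ∎

cFuel-digit1 : ∀ f n → suc n % 3 ≡ 1 → cFuel (suc f) (suc n) ≡ false
cFuel-digit1 f n digit≡1 rewrite digit≡1 = refl

cFuel-digit≢1 : ∀ f n → suc n % 3 ≢ 1 →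
                cFuel (suc f) (suc n) ≡ cFuel f (suc n / 3)
cFuel-digit≢1 f n digit≢1 with suc n % 3
... | zero        = refl
... | suc zero    = ⊥-elim (digit≢1 refl)
... | suc (suc _) = refl

cFuel-irrelevant : ∀ f g n → n < f → n < g → cFuel f n ≡ cFuel g n
cFuel-irrelevant (suc f) (suc g) zero    _         _         = refl
cFuel-irrelevant (suc f) (suc g) (suc n) (s≤s n<f) (s≤s n<g)
  with suc n % 3 ≟ 1
... | yes digit≡1 =
  trans (cFuel-digit1 f n digit≡1) (sym (cFuel-digit1 g n digit≡1))
... | no digit≢1 = begin
  cFuel (suc f) (suc n)  ≡⟨ cFuel-digit≢1 f n digit≢1 ⟩
  cFuel f (suc n / 3)    ≡⟨ cFuel-irrelevant f g (suc n / 3)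
                              (<-≤-trans parent<n n<f) (<-≤-trans parent<n n<g) ⟩
  cFuel g (suc n / 3)    ≡⟨ cFuel-digit≢1 g n digit≢1 ⟨
  cFuel (suc g) (suc n)  ∎
  where
  parent<n : suc n / 3 < suc n
  parent<n = m/n<m (suc n) 3 (s≤s (s≤s z≤n))

c-parent : ∀ n → suc n % 3 ≢ 1 → c (suc n) ≡ c (suc n / 3)
c-parent n digit≢1 = trans (cFuel-digit≢1 (suc n) n digit≢1)
  (cFuel-irrelevant (suc n) (suc (suc n / 3)) (suc n / 3)
    (m/n<m (suc n) 3 (s≤s (s≤s z≤n))) ≤-refl)

digit≢1 : ∀ e q → e < 3 → e ≢ 1 → (e + q * 3) % 3 ≢ 1
digit≢1 e q e<3 e≢1 digit≡1 = e≢1 (trans (sym (digit-% e q e<3)) digit≡1)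

c-digit0 : ∀ q → c (q * 3) ≡ c q
c-digit0 zero    = refl
c-digit0 (suc q) = trans (c-parent (2 + q * 3) (digit≢1 0 (suc q) 0<3 λ ()))
                         (cong c (digit-/ 0 (suc q) 0<3))
  where 0<3 : 0 < 3
        0<3 = s≤s z≤n

c-digit1 : ∀ q → c (1 + q * 3) ≡ false
c-digit1 q = cFuel-digit1 (1 + q * 3) (q * 3) (digit-% 1 q (s≤s (s≤s z≤n)))

c-digit2 : ∀ q → c (2 + q * 3) ≡ c q
c-digit2 q = trans (c-parent (1 + q * 3) (digit≢1 2 q 2<3 λ ()))
                   (cong c (digit-/ 2 q 2<3))
  where 2<3 : 2 < 3
        2<3 = s≤s (s≤s (s≤s z≤n))

-- The two digits a letter 1 can sit on: 0 (coded true) and 2 (coded false).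
residue : Bool → ℕ
residue true  = 0
residue false = 2

c-residue-digit : ∀ b q → c (residue b + q * 3) ≡ c q
c-residue-digit true  = c-digit0
c-residue-digit false = c-digit2

Neighbourhood : Bool → ℕ → Set
Neighbourhood b p = c (p + 2) ≡ b × (∀ p₀ → p ≡ 2 + p₀ → c p₀ ≡ not b)

neighbourhood-digit0 : ∀ q → c q ≡ true → Neighbourhood true (q * 3)
neighbourhood-digit0 q cq≡1 =
  trans (cong c (+-comm (q * 3) 2)) (trans (c-digit2 q) cq≡1) , left q
  where
  left : ∀ q p₀ → q * 3 ≡ 2 + p₀ → c p₀ ≡ false
  left (suc q) p₀ eq =
    subst (λ x → c x ≡ false) (suc-injective (suc-injective eq)) (c-digit1 q)

neighbourhood-digit2 : ∀ q → c q ≡ true → Neighbourhood false (2 + q * 3)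
neighbourhood-digit2 q cq≡1 = right , left
  where
  right : c (2 + q * 3 + 2) ≡ false
  right = trans (cong (λ x → c (2 + x)) (+-comm (q * 3) 2)) (c-digit1 (suc q))
  left : ∀ p₀ → 2 + q * 3 ≡ 2 + p₀ → c p₀ ≡ true
  left p₀ eq = subst (λ x → c x ≡ true) (+-cancelˡ-≡ 2 _ _ eq)
                     (trans (c-digit0 q) cq≡1)

one-neighbourhood-digit : ∀ e q → e < 3 → c (e + q * 3) ≡ true →
  ∃ λ b → e ≡ residue b × Neighbourhood b (e + q * 3)
one-neighbourhood-digit 0 q _ c≡1 =
  true , refl , neighbourhood-digit0 q (trans (sym (c-digit0 q)) c≡1)
one-neighbourhood-digit 1 q _ c≡1 with trans (sym (c-digit1 q)) c≡1
... | ()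
one-neighbourhood-digit 2 q _ c≡1 =
  false , refl , neighbourhood-digit2 q (trans (sym (c-digit2 q)) c≡1)
one-neighbourhood-digit (suc (suc (suc _))) q (s≤s (s≤s (s≤s ()))) _

one-neighbourhood : ∀ p → c p ≡ true →
  ∃ λ b → p % 3 ≡ residue b × Neighbourhood b p
one-neighbourhood p cp≡1 =
  subst (λ x → ∃ λ b → p % 3 ≡ residue b × Neighbourhood b x) (sym p≡)
    (one-neighbourhood-digit (p % 3) (p / 3) (m%n<n p 3)
      (subst (λ x → c x ≡ true) p≡ cp≡1))
  where p≡ : p ≡ p % 3 + p / 3 * 3
        p≡ = m≡m%n+[m/n]*n p 3

parent-of-one : ∀ e q → e < 3 → c (e + q * 3) ≡ true → c q ≡ true
parent-of-one e q e<3 c≡1 with one-neighbourhood-digit e q e<3 c≡1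
... | b , refl , _ = trans (sym (c-residue-digit b q)) c≡1

Agree : ℕ → ℕ → ℕ → Set
Agree L y y' = ∀ k → k < L → c (y + k) ≡ c (y' + k)

right-agrees : ∀ {L y y' b b'} a → a + 2 < L → Agree L y y' →
  Neighbourhood b (y + a) → Neighbourhood b' (y' + a) → b ≡ b'
right-agrees {L} {y} {y'} {b} {b'} a a+2<L agree (right , _) (right' , _) = begin
  b                ≡⟨ right ⟨
  c (y + a + 2)    ≡⟨ cong c (+-assoc y a 2) ⟩
  c (y + (a + 2))  ≡⟨ agree (a + 2) a+2<L ⟩
  c (y' + (a + 2)) ≡⟨ cong c (+-assoc y' a 2) ⟨
  c (y' + a + 2)   ≡⟨ right' ⟩
  b'               ∎

left-agrees : ∀ {L y y' b b'} a₀ → a₀ < L → Agree L y y' →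
  Neighbourhood b (y + (2 + a₀)) → Neighbourhood b' (y' + (2 + a₀)) → b ≡ b'
left-agrees {L} {y} {y'} {b} {b'} a₀ a₀<L agree (_ , left) (_ , left') =
  not-injective (begin
    not b        ≡⟨ left (y + a₀) (two-left y) ⟨
    c (y + a₀)   ≡⟨ agree a₀ a₀<L ⟩
    c (y' + a₀)  ≡⟨ left' (y' + a₀) (two-left y') ⟩
    not b'       ∎)
  where
  two-left : ∀ x → x + (2 + a₀) ≡ 2 + (x + a₀)
  two-left x = trans (+-suc x (suc a₀)) (cong suc (+-suc x a₀))

-- In a window of length > 3 one of the two positions is always available.
neighbourhoods-agree : ∀ {L y y' b b'} a → 3 < L → a < L → Agree L y y' →
  Neighbourhood b (y + a) → Neighbourhood b' (y' + a) → b ≡ b'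
neighbourhoods-agree 0 3<L _ = right-agrees 0 (<-trans (s≤s (s≤s (s≤s z≤n))) 3<L)
neighbourhoods-agree 1 3<L _ = right-agrees 1 3<L
neighbourhoods-agree (suc (suc a₀)) _ a<L =
  left-agrees a₀ (<-trans (n<1+n a₀) (<-trans (n<1+n (suc a₀)) a<L))

%-cancelʳ-+ : ∀ {d} .{{_ : NonZero d}} m n a → (m + a) % d ≡ (n + a) % d → m % d ≡ n % d
%-cancelʳ-+ {suc d} m n a eq = begin
  m % suc d                              ≡⟨ [m+kn]%n≡m%n m a (suc d) ⟨
  (m + a * suc d) % suc d                ≡⟨ cong (_% suc d) (regroup m) ⟩
  (m + a + a * d) % suc d                ≡⟨ %-distribˡ-+ (m + a) (a * d) (suc d) ⟩
  ((m + a) % suc d + a * d % suc d) % suc d ≡⟨ cong (λ x → (x + a * d % suc d) % suc d) eq ⟩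
  ((n + a) % suc d + a * d % suc d) % suc d ≡⟨ %-distribˡ-+ (n + a) (a * d) (suc d) ⟨
  (n + a + a * d) % suc d                ≡⟨ cong (_% suc d) (regroup n) ⟨
  (n + a * suc d) % suc d                ≡⟨ [m+kn]%n≡m%n n a (suc d) ⟩
  n % suc d                              ∎
  where
  regroup : ∀ x → x + a * suc d ≡ x + a + a * d
  regroup x = begin
    x + a * suc d    ≡⟨ cong (x +_) (*-suc a d) ⟩
    x + (a + a * d)  ≡⟨ +-assoc x a (a * d) ⟨
    x + a + a * d    ∎

agree⇒≡%3 : ∀ {L y y'} a → 3 < L → a < L → c (y + a) ≡ true → Agree L y y' →
  y % 3 ≡ y' % 3
agree⇒≡%3 {L} {y} {y'} a 3<L a<L one agree
  with one-neighbourhood (y + a) one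
     | one-neighbourhood (y' + a) (trans (sym (agree a a<L)) one)
... | b , y+a≡ , nb | b' , y'+a≡ , nb' = %-cancelʳ-+ y y' a (begin
  (y + a) % 3   ≡⟨ y+a≡ ⟩
  residue b     ≡⟨ cong residue (neighbourhoods-agree a 3<L a<L agree nb nb') ⟩
  residue b'    ≡⟨ y'+a≡ ⟨
  (y' + a) % 3  ∎)

-- The windows of the desubstituted positions have length ⌈ n / 3 ⌉; the
-- block x lies in such a window exactly when x * 3 < n.
⌈_/3⌉ : ℕ → ℕ
⌈ n /3⌉ = (2 + n) / 3

<-⌈/3⌉⇒ : ∀ x n → x < ⌈ n /3⌉ → x * 3 < n
<-⌈/3⌉⇒ x n x<⌈n/3⌉ =
  ≤-pred (≤-pred (≤-trans (*-monoˡ-≤ 3 x<⌈n/3⌉) (m/n*n≤m (2 + n) 3)))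

⇒<-⌈/3⌉ : ∀ x n → x * 3 < n → x < ⌈ n /3⌉
⇒<-⌈/3⌉ x n x*3<n =
  subst (_≤ ⌈ n /3⌉) (m*n/n≡m (suc x) 3) (/-monoˡ-≤ 3 (s≤s (s≤s x*3<n)))

shift-blocks : ∀ r Y d e t → r + d ≡ e + t * 3 → r + Y * 3 + d ≡ e + (Y + t) * 3
shift-blocks r Y d e t eq = begin
  r + Y * 3 + d        ≡⟨ move-digit r Y d ⟩
  Y * 3 + (r + d)      ≡⟨ cong (Y * 3 +_) eq ⟩
  Y * 3 + (e + t * 3)  ≡⟨ move-digit e Y (t * 3) ⟨
  e + Y * 3 + t * 3    ≡⟨ +-assoc e (Y * 3) (t * 3) ⟩
  e + (Y * 3 + t * 3)  ≡⟨ cong (e +_) (*-distribʳ-+ 3 Y t) ⟨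
  e + (Y + t) * 3      ∎
  where
  move-digit : ∀ r Y d → r + Y * 3 + d ≡ Y * 3 + (r + d)
  move-digit = solve-∀

-- Every block t of the parent window meets the child window in a position
-- d whose digit is 0 or 2 (so that it copies the letter of block t).
block-representative : ∀ r t L → r < 3 → 1 < L → t * 3 < r + L →
  ∃₂ λ d b → d < L × r + d ≡ residue b + t * 3
block-representative 0 zero    L _ 1<L _ = 0 , true , <-trans (s≤s z≤n) 1<L , refl
block-representative 1 zero    L _ 1<L _ = 1 , false , 1<L , refl
block-representative 2 zero    L _ 1<L _ = 0 , false , <-trans (s≤s z≤n) 1<L , refl
block-representative 0 (suc t) L _ _ 3t<L = suc t * 3 , true , 3t<L , refl
block-representative 1 (suc t) L _ _ (s≤s 3t<L) = 2 + t * 3 , true , 3t<L , refl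
block-representative 2 (suc t) L _ _ (s≤s (s≤s 3t<L)) = 1 + t * 3 , true , 3t<L , refl
block-representative (suc (suc (suc _))) _ _ (s≤s (s≤s (s≤s ()))) _ _

agree-desubstitute : ∀ {L} r Y Y' → r < 3 → 1 < L →
  Agree L (r + Y * 3) (r + Y' * 3) → Agree ⌈ r + L /3⌉ Y Y'
agree-desubstitute {L} r Y Y' r<3 1<L agree t t<L₁
  with block-representative r t L r<3 1<L (<-⌈/3⌉⇒ t (r + L) t<L₁)
... | d , b , d<L , r+d≡ = begin
  c (Y + t)                     ≡⟨ c-residue-digit b (Y + t) ⟨
  c (residue b + (Y + t) * 3)   ≡⟨ cong c (shift-blocks r Y d (residue b) t r+d≡) ⟨
  c (r + Y * 3 + d)             ≡⟨ agree d d<L ⟩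
  c (r + Y' * 3 + d)            ≡⟨ cong c (shift-blocks r Y' d (residue b) t r+d≡) ⟩
  c (residue b + (Y' + t) * 3)  ≡⟨ c-residue-digit b (Y' + t) ⟩
  c (Y' + t)                    ∎

-- y ≡ y' (mod M), in a form that needs no subtraction.
ModEq : ℕ → ℕ → ℕ → Set
ModEq M y y' = ∃₂ λ s s' → y + s * M ≡ y' + s' * M

modEq-1 : ∀ y y' → ModEq 1 y y'
modEq-1 y y' = y' , y , (begin
  y + y' * 1  ≡⟨ cong (y +_) (*-identityʳ y') ⟩
  y + y'      ≡⟨ +-comm y y' ⟩
  y' + y      ≡⟨ cong (y' +_) (*-identityʳ y) ⟨
  y' + y * 1  ∎)

modEq-scale : ∀ k M r Y Y' → ModEq M Y Y' → ModEq (k * M) (r + Y * k) (r + Y' * k)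
modEq-scale k M r Y Y' (s , s' , eq) = s , s' , (begin
  r + Y * k + s * (k * M)   ≡⟨ regroup r Y k s M ⟩
  r + (Y + s * M) * k       ≡⟨ cong (λ x → r + x * k) eq ⟩
  r + (Y' + s' * M) * k     ≡⟨ regroup r Y' k s' M ⟨
  r + Y' * k + s' * (k * M) ∎)
  where
  regroup : ∀ r Y k s M → r + Y * k + s * (k * M) ≡ r + (Y + s * M) * k
  regroup = solve-∀

modEq⇒%≡ : ∀ {M} .{{_ : NonZero M}} {y y'} → ModEq M y y' → y % M ≡ y' % M
modEq⇒%≡ {M} {y = y} {y'} (s , s' , eq) = begin
  y % M             ≡⟨ [m+kn]%n≡m%n y s M ⟨
  (y + s * M) % M   ≡⟨ cong (_% M) eq ⟩
  (y' + s' * M) % M ≡⟨ [m+kn]%n≡m%n y' s' M ⟩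
  y' % M            ∎

synchronise : ∀ ℓ {L y y'} a → 3 ^ ℓ < L → a < L → c (y + a) ≡ true →
  Agree L y y' → ModEq (3 ^ ℓ) y y'
synchronise zero    {y = y} {y'} _ _ _ _ _ = modEq-1 y y'
synchronise (suc ℓ) {L} {y} {y'} a 3M<L a<L one agree =
  subst₂ (ModEq (3 ^ suc ℓ)) (sym y≡) (sym y'≡)
    (modEq-scale 3 M r Y Y'
      (synchronise ℓ t (⇒<-⌈/3⌉ M (r + L) 3M<r+L) (⇒<-⌈/3⌉ t (r + L) 3t<r+L)
        parent-one parent-agree))
  where
  M r Y Y' : ℕ
  M = 3 ^ ℓ
  r = y % 3
  Y = y / 3
  Y' = y' / 3
  3<L : 3 < L
  3<L = ≤-<-trans (*-monoʳ-≤ 3 (m^n>0 3 ℓ)) 3M<L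
  y≡ : y ≡ r + Y * 3
  y≡ = m≡m%n+[m/n]*n y 3
  y'≡ : y' ≡ r + Y' * 3
  y'≡ = trans (m≡m%n+[m/n]*n y' 3)
              (cong (_+ Y' * 3) (sym (agree⇒≡%3 {L} {y} {y'} a 3<L a<L one agree)))
  parent-agree : Agree ⌈ r + L /3⌉ Y Y'
  parent-agree = agree-desubstitute r Y Y' (m%n<n y 3) (<-trans (s≤s (s≤s z≤n)) 3<L)
                   (subst₂ (Agree L) y≡ y'≡ agree)
  -- the 1 at offset a lies in block t = ⌊(r + a)/3⌋, at digit e
  e t : ℕ
  e = (r + a) % 3
  t = (r + a) / 3
  parent-one : c (Y + t) ≡ true
  parent-one = parent-of-one e (Y + t) (m%n<n (r + a) 3) (begin
    c (e + (Y + t) * 3)  ≡⟨ cong c (shift-blocks r Y a e t (m≡m%n+[m/n]*n (r + a) 3)) ⟨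
    c (r + Y * 3 + a)    ≡⟨ cong (λ x → c (x + a)) y≡ ⟨
    c (y + a)            ≡⟨ one ⟩
    true                 ∎)
  3t<r+L : t * 3 < r + L
  3t<r+L = ≤-<-trans (m/n*n≤m (r + a) 3) (+-monoʳ-< r a<L)
  3M<r+L : M * 3 < r + L
  3M<r+L = ≤-trans (subst (_< L) (*-comm 3 M) 3M<L) (m≤n+m L r)

occurrences-agree : ∀ {u i i'} → OccursAt u i → OccursAt u i' → Agree (length u) i i'
occurrences-agree {u} {i} {i'} occ occ' k k<|u| = begin
  c (i + k)                   ≡⟨ cong (λ x → c (i + x)) (toℕ-fromℕ< k<|u|) ⟨
  c (i + toℕ (fromℕ< k<|u|))  ≡⟨ occ (fromℕ< k<|u|) ⟨
  lookup u (fromℕ< k<|u|)     ≡⟨ occ' (fromℕ< k<|u|) ⟩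
  c (i' + toℕ (fromℕ< k<|u|)) ≡⟨ cong (λ x → c (i' + x)) (toℕ-fromℕ< k<|u|) ⟩
  c (i' + k)                  ∎

one-in-occurrence : ∀ {u i} → true ∈ u → OccursAt u i →
  ∃ λ a → a < length u × c (i + a) ≡ true
one-in-occurrence one∈u occ =
  toℕ (index one∈u) , toℕ<n (index one∈u) ,
  trans (sym (occ (index one∈u))) (sym (lookup-index one∈u))

-- Type(ℓ, u) is the single residue class modulo 3^ℓ of any occurrence of u.
lemma4p3 : (ℓ : ℕ) → 1 ≤ ℓ → (u : List Bool) → IsFactor u → true ∈ u →
           3 ^ ℓ < length u → CardOne (InType ℓ u)
lemma4p3 ℓ _ u (i , occ) one∈u 3^ℓ<|u| =
  i % M , (m%n<n i M , i / M , subst (OccursAt u) i≡ occ) , unique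
  where
  M : ℕ
  M = 3 ^ ℓ
  instance
    M≢0 : NonZero M
    M≢0 = m^n≢0 3 ℓ
  i≡ : i ≡ M * (i / M) + i % M
  i≡ = trans (m≡m%n+[m/n]*n i M) (trans (+-comm (i % M) _) (cong (_+ i % M) (*-comm (i / M) M)))
  unique : ∀ j → InType ℓ u j → j ≡ i % M
  unique j (j<M , n , occ') with one-in-occurrence {u} {i} one∈u occ
  ... | a , a<|u| , one = begin
    j                ≡⟨ m<n⇒m%n≡m j<M ⟨
    j % M            ≡⟨ %-remove-+ˡ j (m∣m*n {M} n) ⟨
    (M * n + j) % M  ≡⟨ modEq⇒%≡ (synchronise ℓ {y = i} a 3^ℓ<|u| a<|u| one agree) ⟨
    i % M            ∎
    where agree : Agree (length u) i (M * n + j)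
          agree = occurrences-agree {u} {i} {M * n + j} occ occ'
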